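{- Let $t$ be a positive integer and let $G_t$, $T_t$ be as constructed below. For every chordal trigraph $H$ whose total graph $\mathcal T(H)$ has clique number at most $t+1$, every set $X\subseteq V(G_t)$ such that $G_t[X]$ is $H$-free, and every $u\in V(G_t)$, there exists a downward path $P_u$ from $u$ in $T_t$ with $|V(P_u)\cap X| \le |V(H)|-1$.
   Context: A trigraph is a triple $(V,E_B,E_R)$ with $E_B, E_R$ disjoint subsets of $\binom V2$ (black and red edges); the adjacency type of a pair $uv$ is black, red, or non-edge. The total graph $\mathcal T(G)$ is $(V,E_B\cup E_R)$; a trigraph is chordal if its total graph is chordal. For $X \subseteq V$, $G[X]$ is the trigraph on $X$ keeping the black and red edges inside $X$. Trigraphs are isomorphic if there is a bijection preserving adjacency types; $G$ is $H$-free if no induced subtrigraph of $G$ is isomorphic to $H$. Construction of $G_t$ and rooted tree $T_t$ (same vertex set): layers $L_0, L_1,\dots$, each a finite path of black edges ordered left to right; $L_0$ is a single vertex, the root of $T_t$. Given $L_{\le i}=L_0\cup\dots\cup L_i$, build $L_{i+1}$: for each $u\in L_i$ from left to right, let $N^\uparrow[u] := (N_{\mathcal T(G_t)}(u)\cap L_{\le i-1})\cup\{u\}$; for every ordered pair $(B,R)$ of disjoint subsets of $N^\uparrow[u]$ with $|B\cup R|\le t$, append a new vertex $v_{B,R}$ at the right end of $L_{i+1}$, joined by a black edge to the previous rightmost vertex of $L_{i+1}$ (if any), make it a child of $u$ in $T_t$, and add black edges from $v_{B,R}$ to all of $B$ and red edges to all of $R$. A downward path from $u$ is an infinite path $u_1u_2\dots$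 in $T_t$ with $u_1=u$ and $u_{i-1}$ the parent of $u_i$ for all $i>1$. -}

module Defs where

open import Data.Nat using (ℕ; zero; suc; _≤_; _<_; _≤ᵇ_; _∸_)
open import Data.Bool using (Bool; true; false; T; not; _∧_; _∨_)
open import Data.Fin using (Fin; toℕ)
open import Data.Fin.Subset using (Subset; _∪_; ∣_∣)
open import Data.Vec using (Vec; []; _∷_)
open import Data.List using (List; []; _∷_; _++_; length)
open import Data.List.Membership.Propositional using (_∈_)
open import Data.Product using (Σ; Σ-syntax; _×_; _,_)
open import Data.Sum using (_⊎_)
open import Data.Empty using (⊥)
open import Relation.Nullary using (¬_)
open import Relation.Binary.PropositionalEquality using (_≡_; _≢_)
open import Function.Definitions using (Injective)
open import Function.Bundles using (_⇔_)

select : {A : Set} → (xs : List A) → Subset (length xs) → List A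
select []       []            = []
select (x ∷ xs) (true  ∷ bs) = x ∷ select xs bs
select (x ∷ xs) (false ∷ bs) = select xs bs

disjointᵇ : {k : ℕ} → Subset k → Subset k → Bool
disjointᵇ []       []       = true
disjointᵇ (x ∷ xs) (y ∷ ys) = not (x ∧ y) ∧ disjointᵇ xs ys

record Trigraph : Set where
  field
    n       : ℕ
    black   : Fin n → Fin n → Bool
    red     : Fin n → Fin n → Bool
    black-sym  : ∀ i j → black i j ≡ black j i
    red-sym    : ∀ i j → red i j ≡ red j i
    black-irr  : ∀ i → black i i ≡ false
    red-irr    : ∀ i → red i i ≡ false
    disjoint   : ∀ i j → T (black i j) → T (red i j) → ⊥

module _ (H : Trigraph) where
  open Trigraph H

  TAdj : Fin n → Fin n → Set
  TAdj i j = T (black i j ∨ red i j)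

  CycNext : (k : ℕ) → Fin k → Fin k → Set
  CycNext k i j = (suc (toℕ i) ≡ toℕ j) ⊎ ((suc (toℕ i) ≡ k) × (toℕ j ≡ 0))

  Chordal : Set
  Chordal = (k : ℕ) → 4 ≤ k → (c : Fin k → Fin n) → Injective _≡_ _≡_ c →
            (∀ i j → CycNext k i j → TAdj (c i) (c j)) →
            Σ[ i ∈ Fin k ] Σ[ j ∈ Fin k ]
              (i ≢ j × ¬ CycNext k i j × ¬ CycNext k j i × TAdj (c i) (c j))

  CliqueNumberAtMost : ℕ → Set
  CliqueNumberAtMost w = (m : ℕ) (f : Fin m → Fin n) → Injective _≡_ _≡_ f →
                         (∀ i j → i ≢ j → TAdj (f i) (f j)) → m ≤ w

module Construction (t : ℕ) where

  -- A vertex is the root, or a child v_{B,R} of a vertex p, where B, R are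
  -- disjoint subsets of N↑[p] (given as a list) with |B ∪ R| ≤ t.
  -- up v is N↑[v] = (N_{𝒯(G_t)}(v) ∩ L_{≤ i-1}) ∪ {v}, which for the
  -- constructed graph is {v} ∪ B_v ∪ R_v (all edges from v to earlier
  -- layers are exactly those added when v was created).
  data Vtx : Set
  up : Vtx → List Vtx

  data Vtx where
    root  : Vtx
    child : (p : Vtx) (B R : Subset (length (up p))) →
            T (disjointᵇ B R) → T (∣ B ∪ R ∣ ≤ᵇ t) → Vtx

  up root = root ∷ []
  up (child p B R d s) = child p B R d s ∷ (select (up p) B ++ select (up p) R)

  IsChildOf : Vtx → Vtx → Set
  IsChildOf w root                = ⊥
  IsChildOf w (child p _ _ _ _)   = p ≡ w

  SameParent : Vtx → Vtx → Set
  SameParent (child p _ _ _ _) (child q _ _ _ _) = p ≡ q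
  SameParent _ _ = ⊥

  -- The order in which the pairs (B,R) are enumerated below a vertex is
  -- unspecified by the construction; it is encoded by a rank that is
  -- injective among siblings (children are appended in increasing rank).
  RankInjective : (Vtx → ℕ) → Set
  RankInjective rank = ∀ v w → SameParent v w → rank v ≡ rank w → v ≡ w

  UpBlack : Vtx → Vtx → Set
  UpBlack root w = ⊥
  UpBlack (child p B R _ _) w = w ∈ select (up p) B

  UpRed : Vtx → Vtx → Set
  UpRed root w = ⊥
  UpRed (child p B R _ _) w = w ∈ select (up p) R

  DownwardPath : Vtx → (ℕ → Vtx) → Set
  DownwardPath u s = (s 0 ≡ u) × (∀ i → IsChildOf (s i) (s (suc i)))

  PathHitsAtMost : (ℕ → Vtx) → (Vtx → Set) → ℕ → Set
  PathHitsAtMost s X b = (m : ℕ) (f : Fin m → Vtx) → Injective _≡_ _≡_ f →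
                         (∀ j → X (f j) × Σ[ i ∈ ℕ ] s i ≡ f j) → m ≤ b

  module Edges (rank : Vtx → ℕ) where

    _≺_ : Vtx → Vtx → Set
    root ≺ _ = ⊥
    child _ _ _ _ _ ≺ root = ⊥
    v@(child p _ _ _ _) ≺ w@(child q _ _ _ _) = (p ≺ q) ⊎ ((p ≡ q) × (rank v < rank w))

    Consec : Vtx → Vtx → Set
    Consec v w = (v ≺ w) × ¬ (Σ[ z ∈ Vtx ] (v ≺ z × z ≺ w))

    Black : Vtx → Vtx → Set
    Black v w = Consec v w ⊎ Consec w v ⊎ UpBlack v w ⊎ UpBlack w v

    Red : Vtx → Vtx → Set
    Red v w = UpRed v w ⊎ UpRed w v

    ContainsInduced : Trigraph → (Vtx → Set) → Set
    ContainsInduced H X =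
      Σ[ φ ∈ (Fin (Trigraph.n H) → Vtx) ]
        (Injective _≡_ _≡_ φ × (∀ i → X (φ i)) ×
         (∀ i j → i ≢ j →
            (T (Trigraph.black H i j) ⇔ Black (φ i) (φ j)) ×
            (T (Trigraph.red H i j) ⇔ Red (φ i) (φ j))))

    InducedFree : Trigraph → (Vtx → Set) → Set
    InducedFree H X = ¬ ContainsInduced H X

{-# OPTIONS --safe #-}
-- If no downward path from u meets X at most |V(H)| − 1 times, H embeds into G_t[X] as an induced
-- subtrigraph. The embedding is built recursively from a vertex y, a clique K of placed vertices of H
-- whose images lie in N↑[y], and the set D of unplaced vertices, all of whose placed neighbours lie in K.
-- Pick d ∈ D with the most neighbours in K and walk down from y through the children v_{B,R} whose B and
-- R are the images of the black and red neighbours of d in K (at most t of them: with d they form a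
-- clique of 𝒯(H)). The first vertex x of X on the way that is neither used nor next to a used vertex of
-- its layer receives d, and its edges to earlier layers are exactly the right ones. The other vertices of
-- D that reach K ∖ N(d) inside D are placed below y again (by chordality none of them is adjacent to d);
-- the rest are placed below x with the clique {d} ∪ (K ∩ N(d)). Every path below y meets X at least |D|
-- times plus once per vertex already placed below y, which pays for all the walks.
module Submission where

open import Defs
open import Level using (0ℓ)
open import Axiom.ExcludedMiddle using (ExcludedMiddle)
open import Data.Nat
open import Data.Nat.Properties
open import Data.Nat.GeneralisedArithmetic using (iterate)
open import Data.Bool using (true; false; T; _∨_)
open import Data.Bool.Properties using (T-∨)
open import Data.Fin as Fin using (Fin; zero; suc; toℕ; punchIn)
open import Data.Fin.Properties using (toℕ-injective; toℕ<n; punchIn-injective; punchInᵢ≢i)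
open import Data.Fin.Subset using (Subset; _∪_; ∣_∣)
open import Data.Vec using ([]; _∷_)
open import Data.List using (List; []; _∷_; _++_; length; lookup; filter; allFin)
open import Data.List.Properties
  using (length-++; ++-assoc; length-tabulate; filter-++; filter-accept; filter-reject; filter-all; filter-notAll; length-filter)
open import Data.List.Membership.Propositional using (_∈_; _∉_)
open import Data.List.Membership.Propositional.Properties
  using (∈-++⁺ˡ; ∈-++⁺ʳ; ∈-++⁻; ∈-filter⁺; ∈-filter⁻; ∈-allFin; ∈-lookup)
open import Data.List.Relation.Unary.Any as Any using (here; there)
open import Data.List.Relation.Unary.All as All using (All; [])
open import Data.List.Relation.Unary.AllPairs using ([]; _∷_)
open import Data.List.Relation.Unary.Unique.Propositional using (Unique)
open import Data.List.Relation.Unary.Unique.Propositional.Properties using (++⁺)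
open import Data.List.Relation.Binary.Disjoint.Propositional using (Disjoint)
open import Data.List.Extrema.Nat using (argmax; argmax-sel; f[⊥]≤f[argmax]; f[xs]≤f[argmax])
open import Data.Product
open import Data.Sum as Sum using (_⊎_; inj₁; inj₂; [_,_]′)
open import Data.Empty
open import Data.Unit using (tt)
open import Function using (id; _∘_; _⇔_; mk⇔; Equivalence)
open import Function.Definitions using (Injective)
open import Relation.Nullary
open import Relation.Nullary.Decidable using (T?)
open import Relation.Unary using (Pred; Decidable)
open import Relation.Binary.PropositionalEquality
open import Relation.Binary.Definitions using (tri<; tri≈; tri>)

module _ {A : Set} where

  select-⊆ : ∀ (xs : List A) B {z} → z ∈ select xs B → z ∈ xs
  select-⊆ []       []          ()
  select-⊆ (x ∷ xs) (true  ∷ B) (here p)  = here p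
  select-⊆ (x ∷ xs) (true  ∷ B) (there m) = there (select-⊆ xs B m)
  select-⊆ (x ∷ xs) (false ∷ B) m         = there (select-⊆ xs B m)

  select-Unique : ∀ (xs : List A) B → Unique xs → Unique (select xs B)
  select-Unique []       []          _         = []
  select-Unique (x ∷ xs) (true  ∷ B) (x∉ ∷ u) = All.tabulate (All.lookup x∉ ∘ select-⊆ xs B) ∷ select-Unique xs B u
  select-Unique (x ∷ xs) (false ∷ B) (_  ∷ u) = select-Unique xs B u

  select-disjoint : ∀ (xs : List A) B R → Unique xs → T (disjointᵇ B R) → Disjoint (select xs B) (select xs R)
  select-disjoint []       []          []          _         _  (() , _)
  select-disjoint (x ∷ xs) (true  ∷ B) (true  ∷ R) _         ()
  select-disjoint (x ∷ xs) (true  ∷ B) (false ∷ R) (x∉ ∷ u) _  (here refl , m)  = All.lookup x∉ (select-⊆ xs R m) refl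
  select-disjoint (x ∷ xs) (true  ∷ B) (false ∷ R) (_  ∷ u) dj (there m₁ , m₂) = select-disjoint xs B R u dj (m₁ , m₂)
  select-disjoint (x ∷ xs) (false ∷ B) (true  ∷ R) (x∉ ∷ u) _  (m , here refl)  = All.lookup x∉ (select-⊆ xs B m) refl
  select-disjoint (x ∷ xs) (false ∷ B) (true  ∷ R) (_  ∷ u) dj (m₁ , there m₂) = select-disjoint xs B R u dj (m₁ , m₂)
  select-disjoint (x ∷ xs) (false ∷ B) (false ∷ R) (_  ∷ u) dj ms               = select-disjoint xs B R u dj ms

  select-∪⁻ : ∀ (xs : List A) B R {z} → z ∈ select xs (B ∪ R) → z ∈ select xs B ⊎ z ∈ select xs R
  select-∪⁻ []       []          []          ()
  select-∪⁻ (x ∷ xs) (true  ∷ B) (r     ∷ R) (here p)  = inj₁ (here p)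
  select-∪⁻ (x ∷ xs) (false ∷ B) (true  ∷ R) (here p)  = inj₂ (here p)
  select-∪⁻ (x ∷ xs) (true  ∷ B) (true  ∷ R) (there m) = Sum.map there there (select-∪⁻ xs B R m)
  select-∪⁻ (x ∷ xs) (true  ∷ B) (false ∷ R) (there m) = Sum.map₁ there (select-∪⁻ xs B R m)
  select-∪⁻ (x ∷ xs) (false ∷ B) (true  ∷ R) (there m) = Sum.map₂ there (select-∪⁻ xs B R m)
  select-∪⁻ (x ∷ xs) (false ∷ B) (false ∷ R) m         = select-∪⁻ xs B R m

  ∣∣≡length-select : ∀ (xs : List A) B → ∣ B ∣ ≡ length (select xs B)
  ∣∣≡length-select []       []          = refl
  ∣∣≡length-select (x ∷ xs) (true  ∷ B) = cong suc (∣∣≡length-select xs B)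
  ∣∣≡length-select (x ∷ xs) (false ∷ B) = ∣∣≡length-select xs B

  lookup-injective : ∀ {xs : List A} → Unique xs → ∀ i j → lookup xs i ≡ lookup xs j → i ≡ j
  lookup-injective (x∉ ∷ u) zero    zero    _  = refl
  lookup-injective (x∉ ∷ u) zero    (suc j) eq = ⊥-elim (All.lookup x∉ (∈-lookup j) eq)
  lookup-injective (x∉ ∷ u) (suc i) zero    eq = ⊥-elim (All.lookup x∉ (∈-lookup i) (sym eq))
  lookup-injective (x∉ ∷ u) (suc i) (suc j) eq = cong suc (lookup-injective u i j eq)

module _ (em : ExcludedMiddle 0ℓ) {A : Set} where

  mask : (xs : List A) → Pred A 0ℓ → Subset (length xs)
  mask []       S = []
  mask (x ∷ xs) S = does (em {S x}) ∷ mask xs S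

  mask⁻ : ∀ xs S {z} → z ∈ select xs (mask xs S) → z ∈ xs × S z
  mask⁻ (x ∷ xs) S z∈ with em {S x}
  mask⁻ (x ∷ xs) S (here refl) | yes Sx = here refl , Sx
  mask⁻ (x ∷ xs) S (there z∈)  | yes _  = map₁ there (mask⁻ xs S z∈)
  mask⁻ (x ∷ xs) S z∈          | no _   = map₁ there (mask⁻ xs S z∈)

  mask⁺ : ∀ xs S {z} → z ∈ xs → S z → z ∈ select xs (mask xs S)
  mask⁺ (x ∷ xs) S z∈ Sz with em {S x}
  mask⁺ (x ∷ xs) S (here refl) Sz | yes _  = here refl
  mask⁺ (x ∷ xs) S (there z∈)  Sz | yes _  = there (mask⁺ xs S z∈ Sz)
  mask⁺ (x ∷ xs) S (here refl) Sz | no ¬Sx = contradiction Sz ¬Sx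
  mask⁺ (x ∷ xs) S (there z∈)  Sz | no _   = mask⁺ xs S z∈ Sz

  mask-disjoint : ∀ xs S₁ S₂ → (∀ {z} → S₁ z → S₂ z → ⊥) → T (disjointᵇ (mask xs S₁) (mask xs S₂))
  mask-disjoint []       S₁ S₂ _   = tt
  mask-disjoint (x ∷ xs) S₁ S₂ S₁∩S₂=∅ with em {S₁ x} | em {S₂ x}
  ... | yes s₁ | yes s₂ = S₁∩S₂=∅ s₁ s₂
  ... | yes _  | no _   = mask-disjoint xs S₁ S₂ S₁∩S₂=∅
  ... | no _   | yes _  = mask-disjoint xs S₁ S₂ S₁∩S₂=∅
  ... | no _   | no _   = mask-disjoint xs S₁ S₂ S₁∩S₂=∅

module _ {A : Set} {P Q : Pred A 0ℓ} (P? : Decidable P) (Q? : Decidable Q) where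

  length-filter-mono : ∀ xs → (∀ {z} → z ∈ xs → P z → Q z) → length (filter P? xs) ≤ length (filter Q? xs)
  length-filter-mono []       _   = z≤n
  length-filter-mono (x ∷ xs) P⇒Q with P? x | Q? x | length-filter-mono xs (P⇒Q ∘ there)
  ... | yes _  | yes _  | ih = s≤s ih
  ... | yes px | no ¬qx | _  = ⊥-elim (¬qx (P⇒Q (here refl) px))
  ... | no _   | yes _  | ih = m≤n⇒m≤1+n ih
  ... | no _   | no _   | ih = ih

  length-filter-mono-< : ∀ xs → (∀ {z} → z ∈ xs → P z → Q z) →
                         ∀ {c} → c ∈ xs → Q c → ¬ P c → length (filter P? xs) < length (filter Q? xs)
  length-filter-mono-< (x ∷ xs) P⇒Q (here refl) qc ¬pc with P? x | Q? x
  ... | yes px | _      = ⊥-elim (¬pc px)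
  ... | no _   | yes _  = s≤s (length-filter-mono xs (P⇒Q ∘ there))
  ... | no _   | no ¬qc = ⊥-elim (¬qc qc)
  length-filter-mono-< (x ∷ xs) P⇒Q (there c∈) qc ¬pc with P? x | Q? x | length-filter-mono-< xs (P⇒Q ∘ there) c∈ qc ¬pc
  ... | yes _  | yes _  | ih = s≤s ih
  ... | yes px | no ¬qx | _  = ⊥-elim (¬qx (P⇒Q (here refl) px))
  ... | no _   | yes _  | ih = m≤n⇒m≤1+n ih
  ... | no _   | no _   | ih = ih

length-filter-+-¬ : ∀ {A : Set} {P : Pred A 0ℓ} (P? : Decidable P) xs →
                    length (filter P? xs) + length (filter (¬? ∘ P?) xs) ≡ length xs
length-filter-+-¬ P? []       = refl
length-filter-+-¬ P? (x ∷ xs) with P? x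
... | yes _ = cong suc (length-filter-+-¬ P? xs)
... | no _  = trans (+-suc _ _) (cong suc (length-filter-+-¬ P? xs))

least-witness : ∀ {P : Pred ℕ 0ℓ} → Decidable P → ∀ k → P k →
                ∃ λ k₀ → k₀ ≤ k × P k₀ × (∀ m → m < k₀ → ¬ P m)
least-witness P? k pk with P? 0
... | yes p₀ = 0 , z≤n , p₀ , λ _ ()
least-witness P? zero    pk | no ¬p₀ = ⊥-elim (¬p₀ pk)
least-witness P? (suc k) pk | no ¬p₀ with least-witness (P? ∘ suc) k pk
... | k₀ , k₀≤k , pk₀ , below =
  suc k₀ , s≤s k₀≤k , pk₀ , λ { zero _ → ¬p₀ ; (suc m) (s≤s m<k₀) → below m m<k₀ }

infixr 5 _◂_
_◂_ : {A : Set} → A → (ℕ → A) → ℕ → A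
(x ◂ s) zero    = x
(x ◂ s) (suc i) = s i

-- skip a δ renumbers a sequence from which the δ entries after position a were deleted.
skip : ℕ → ℕ → ℕ → ℕ
skip a δ m with m ≤? a
... | yes _ = m
... | no _  = m + δ

module Skip (a δ : ℕ) where

  skip-≤ : ∀ {m} → m ≤ a → skip a δ m ≡ m
  skip-≤ {m} m≤a with m ≤? a
  ... | yes _   = refl
  ... | no m≰a = contradiction m≤a m≰a

  skip-> : ∀ {m} → a < m → skip a δ m ≡ m + δ
  skip-> {m} a<m with m ≤? a
  ... | yes m≤a = contradiction m≤a (<⇒≱ a<m)
  ... | no _    = refl

  m≤skip : ∀ m → m ≤ skip a δ m
  m≤skip m with m ≤? a
  ... | yes _ = ≤-refl
  ... | no _  = m≤m+n m δ

  skip-mono-≤ : ∀ {m k} → m ≤ k → skip a δ m ≤ k + δ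
  skip-mono-≤ {m} {k} m≤k with m ≤? a
  ... | yes _ = ≤-trans m≤k (m≤m+n k δ)
  ... | no _  = +-monoˡ-≤ δ m≤k

  skip-mono-< : ∀ {m k} → m < k → skip a δ m < k + δ
  skip-mono-< {m} {k} m<k with m ≤? a
  ... | yes _ = <-≤-trans m<k (m≤m+n k δ)
  ... | no _  = +-monoˡ-< δ m<k

  skip-injective : ∀ {x y} → skip a δ x ≡ skip a δ y → x ≡ y
  skip-injective {x} {y} eq with x ≤? a | y ≤? a
  ... | yes _   | yes _   = eq
  ... | no _    | no _    = +-cancelʳ-≡ δ x y eq
  ... | yes x≤a | no y≰a = contradiction eq (<⇒≢ (≤-<-trans x≤a (<-≤-trans (≰⇒> y≰a) (m≤m+n y δ))))
  ... | no x≰a  | yes y≤a = contradiction (sym eq) (<⇒≢ (≤-<-trans y≤a (<-≤-trans (≰⇒> x≰a) (m≤m+n x δ))))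

shortcut-length : ∀ {a b k} → a ≤ b → b ≤ k → a + (k ∸ b) + (b ∸ a) ≡ k
shortcut-length {a} {b} {k} a≤b b≤k = begin
  a + (k ∸ b) + (b ∸ a)   ≡⟨ +-assoc a (k ∸ b) (b ∸ a) ⟩
  a + ((k ∸ b) + (b ∸ a)) ≡⟨ cong (a +_) (+-comm (k ∸ b) (b ∸ a)) ⟩
  a + ((b ∸ a) + (k ∸ b)) ≡⟨ sym (+-assoc a (b ∸ a) (k ∸ b)) ⟩
  a + (b ∸ a) + (k ∸ b)   ≡⟨ cong (_+ (k ∸ b)) (m+[n∸m]≡n a≤b) ⟩
  b + (k ∸ b)             ≡⟨ m+[n∸m]≡n b≤k ⟩
  k                       ∎
  where open ≡-Reasoning

module Walks {A : Set} (_~_ : A → A → Set) where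

  IsWalk : (ℕ → A) → ℕ → Set
  IsWalk p k = ∀ m → m < k → p m ~ p (suc m)

  InjectiveUpTo : (ℕ → A) → ℕ → Set
  InjectiveUpTo p k = ∀ a b → a ≤ k → b ≤ k → p a ≡ p b → a ≡ b

  ◂-IsWalk : ∀ {x p k} → x ~ p 0 → IsWalk p k → IsWalk (x ◂ p) (suc k)
  ◂-IsWalk x~p₀ walk zero    _         = x~p₀
  ◂-IsWalk x~p₀ walk (suc m) (s≤s m<k) = walk m m<k

  -- Jump from position a straight to position b + 1 of p.
  module Shortcut (p : ℕ → A) {k a b : ℕ} (a≤b : a ≤ b) (b≤k : b ≤ k) where

    gap : ℕ
    gap = b ∸ a

    open Skip a gap

    length′ : ℕ
    length′ = a + (k ∸ b)

    shortcut : ℕ → A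
    shortcut = p ∘ skip a gap

    length′+gap≡k : length′ + gap ≡ k
    length′+gap≡k = shortcut-length a≤b b≤k

    skip-bound : ∀ {m} → m ≤ length′ → skip a gap m ≤ k
    skip-bound {m} m≤ = subst (skip a gap m ≤_) length′+gap≡k (skip-mono-≤ m≤)

    skip-bound-< : ∀ {m} → m < length′ → skip a gap m < k
    skip-bound-< {m} m< = subst (skip a gap m <_) length′+gap≡k (skip-mono-< m<)

    shortcut-start : shortcut 0 ≡ p 0
    shortcut-start = cong p (skip-≤ z≤n)

    shortcut-end : (b ≡ k → p a ≡ p k) → shortcut length′ ≡ p k
    shortcut-end last with m≤n⇒m<n∨m≡n b≤k
    ... | inj₁ b<k = cong p (trans (skip-> (m<m+n a (m<n⇒0<n∸m b<k))) length′+gap≡k)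
    ... | inj₂ refl = trans (cong p (trans (cong (skip a gap) a+0≡a) (skip-≤ ≤-refl))) (last refl)
      where
      a+0≡a : a + (b ∸ b) ≡ a
      a+0≡a = trans (cong (a +_) (n∸n≡0 b)) (+-identityʳ a)

    shortcut-walk : IsWalk p k → (b < k → p a ~ p (suc b)) → IsWalk shortcut length′
    shortcut-walk walk bridge m m<len with <-cmp m a
    ... | tri< m<a _ _ =
      subst₂ (λ i j → p i ~ p j) (sym (skip-≤ (<⇒≤ m<a))) (sym (skip-≤ m<a))
             (walk m (subst (_< k) (skip-≤ (<⇒≤ m<a)) (skip-bound-< m<len)))
    ... | tri≈ _ refl _ =
      subst₂ (λ i j → p i ~ p j) (sym (skip-≤ ≤-refl)) (sym (trans (skip-> ≤-refl) (cong suc (m+[n∸m]≡n a≤b))))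
             (bridge (subst (_< k) (m+[n∸m]≡n a≤b) (subst (a + gap <_) length′+gap≡k (+-monoˡ-< gap m<len))))
    ... | tri> _ _ a<m =
      subst₂ (λ i j → p i ~ p j) (sym (skip-> a<m)) (sym (skip-> (m<n⇒m<1+n a<m)))
             (walk (m + gap) (subst (_< k) (skip-> a<m) (skip-bound-< m<len)))

    shortcut-injective : InjectiveUpTo p k → InjectiveUpTo shortcut length′
    shortcut-injective inj x y x≤ y≤ eq = skip-injective (inj _ _ (skip-bound x≤) (skip-bound y≤) eq)

  record SimpleSubwalk (p : ℕ → A) (k : ℕ) : Set where
    field
      len       : ℕ
      vertex    : ℕ → A
      start     : vertex 0 ≡ p 0
      end       : vertex len ≡ p k
      walk      : IsWalk vertex len
      injective : InjectiveUpTo vertex len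
      visits    : ∀ m → m ≤ len → ∃ λ m′ → m′ ≤ k × vertex m ≡ p m′

  Repetition : (ℕ → A) → ℕ → Set
  Repetition p k = ∃₂ λ a b → a < b × b ≤ k × p a ≡ p b

  ¬Repetition⇒InjectiveUpTo : ∀ {p k} → ¬ Repetition p k → InjectiveUpTo p k
  ¬Repetition⇒InjectiveUpTo ¬rep a b a≤k b≤k eq with <-cmp a b
  ... | tri< a<b _ _ = contradiction (a , b , a<b , b≤k , eq) ¬rep
  ... | tri≈ _ a≡b _ = a≡b
  ... | tri> _ _ b<a = contradiction (b , a , b<a , a≤k , sym eq) ¬rep

  loop-erase : ExcludedMiddle 0ℓ → ∀ bound k → k ≤ bound → ∀ p → IsWalk p k → SimpleSubwalk p k
  loop-erase em bound k k≤ p walk with em {Repetition p k}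
  ... | no ¬rep = record
    { len = k ; vertex = p ; start = refl ; end = refl ; walk = walk
    ; injective = ¬Repetition⇒InjectiveUpTo ¬rep ; visits = λ m m≤k → m , m≤k , refl }
  loop-erase em zero k k≤0 p walk | yes (a , b , a<b , b≤k , _) = ⊥-elim (n≮0 (≤-trans a<b (≤-trans b≤k k≤0)))
  loop-erase em (suc bound) k k≤ p walk | yes (a , b , a<b , b≤k , pa≡pb) = record
    { len = len ; vertex = vertex ; walk = walk′ ; injective = injective
    ; start = trans start shortcut-start
    ; end = trans end (shortcut-end (trans pa≡pb ∘ cong p))
    ; visits = λ m m≤ → let (m′ , m′≤ , eq) = visits m m≤ in skip a gap m′ , skip-bound m′≤ , eq
    }
    where
    open Shortcut p (<⇒≤ a<b) b≤k
    shorter : length′ ≤ bound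
    shorter = ≤-pred (<-≤-trans (subst (length′ <_) length′+gap≡k (m<m+n length′ (m<n⇒0<n∸m a<b))) k≤)
    bridge : b < k → p a ~ p (suc b)
    bridge b<k = subst (_~ p (suc b)) (sym pa≡pb) (walk b b<k)
    open SimpleSubwalk (loop-erase em bound length′ shorter shortcut (shortcut-walk walk bridge))
      renaming (walk to walk′)

  module Bracket (u v : A) (q : ℕ → A) (l : ℕ) where

    cycle : ℕ → A
    cycle zero = u
    cycle (suc m) with m ≤? l
    ... | yes _ = q m
    ... | no _  = v

    cycle-inner : ∀ {m} → m ≤ l → cycle (suc m) ≡ q m
    cycle-inner {m} m≤l with m ≤? l
    ... | yes _   = refl
    ... | no m≰l = contradiction m≤l m≰l

    cycle-last : cycle (suc (suc l)) ≡ v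
    cycle-last with suc l ≤? l
    ... | yes 1+l≤l = contradiction 1+l≤l 1+n≰n
    ... | no _      = refl

    data Position (x : ℕ) : Set where
      first : x ≡ 0 → cycle x ≡ u → Position x
      inner : ∀ m → x ≡ suc m → m ≤ l → cycle x ≡ q m → Position x
      last  : x ≡ suc (suc l) → cycle x ≡ v → Position x

    position : ∀ x → x ≤ suc (suc l) → Position x
    position zero    _ = first refl refl
    position (suc m) x≤ with m ≤? l
    ... | yes m≤l = inner m refl m≤l (cycle-inner m≤l)
    ... | no m≰l  with ≤-antisym (≤-pred x≤) (≰⇒> m≰l)
    ...   | refl = last refl cycle-last

    cycle-walk : IsWalk q l → u ~ q 0 → q l ~ v → IsWalk cycle (suc (suc l))
    cycle-walk walk u~q₀ qₗ~v zero _ = subst (u ~_) (sym (cycle-inner z≤n)) u~q₀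
    cycle-walk walk u~q₀ qₗ~v (suc m) (s≤s m<) with m≤n⇒m<n∨m≡n (≤-pred m<)
    ... | inj₁ m<l = subst₂ _~_ (sym (cycle-inner (<⇒≤ m<l))) (sym (cycle-inner m<l)) (walk m m<l)
    ... | inj₂ refl = subst₂ _~_ (sym (cycle-inner ≤-refl)) (sym cycle-last) qₗ~v

    cycle-injective : InjectiveUpTo q l → u ≢ v → (∀ m → m ≤ l → q m ≢ u × q m ≢ v) →
                      InjectiveUpTo cycle (suc (suc l))
    cycle-injective inj u≢v outside x y x≤ y≤ eq with position x x≤ | position y y≤
    ... | first refl ex | first refl ey = refl
    ... | first refl ex | inner m refl m≤ ey = ⊥-elim (proj₁ (outside m m≤) (trans (sym ey) (trans (sym eq) ex)))
    ... | first refl ex | last refl ey = ⊥-elim (u≢v (trans (sym ex) (trans eq ey)))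
    ... | inner m refl m≤ ex | first refl ey = ⊥-elim (proj₁ (outside m m≤) (trans (sym ex) (trans eq ey)))
    ... | inner m refl m≤ ex | inner m′ refl m′≤ ey = cong suc (inj m m′ m≤ m′≤ (trans (sym ex) (trans eq ey)))
    ... | inner m refl m≤ ex | last refl ey = ⊥-elim (proj₂ (outside m m≤) (trans (sym ex) (trans eq ey)))
    ... | last refl ex | first refl ey = ⊥-elim (u≢v (trans (sym ey) (trans (sym eq) ex)))
    ... | last refl ex | inner m refl m≤ ey = ⊥-elim (proj₂ (outside m m≤) (trans (sym ey) (trans (sym eq) ex)))
    ... | last refl ex | last refl ey = refl

module TotalGraph (H : Trigraph) where
  open Trigraph H

  infix 4 _~_ _~?_
  _~_ : Fin n → Fin n → Set
  _~_ = TAdj H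

  _~?_ : ∀ a b → Dec (a ~ b)
  a ~? b = T? (black a b ∨ red a b)

  ~-sym : ∀ {a b} → a ~ b → b ~ a
  ~-sym {a} {b} rewrite black-sym a b | red-sym a b = λ a~b → a~b

  open Walks _~_ public

  record IsCycle (c : ℕ → Fin n) (L : ℕ) : Set where
    field
      injective : InjectiveUpTo c L
      walk      : IsWalk c L
      closing   : c L ~ c 0

  Chord : (ℕ → Fin n) → ℕ → Set
  Chord c L = ∃₂ λ a b → a < b × b ≤ L × suc a ≢ b × ¬ (a ≡ 0 × b ≡ L) × c a ~ c b

  Triangle : (ℕ → Fin n) → ℕ → Set
  Triangle c L = ∃ λ m → 0 < m × m < L × c m ~ c 0 × c m ~ c L

  degreeIn : Fin n → List (Fin n) → ℕ
  degreeIn x K = length (filter (x ~?_) K)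

  IsClique : List (Fin n) → Set
  IsClique K = ∀ {a b} → a ∈ K → b ∈ K → a ≢ b → a ~ b

  clique-extension-bound : ∀ {ω K d m} → CliqueNumberAtMost H ω → IsClique K → d ∉ K →
                           (key : Fin m → Fin n) → Injective _≡_ _≡_ key → (∀ i → key i ∈ K × d ~ key i) →
                           suc m ≤ ω
  clique-extension-bound {K = K} {d} {m} ω-bound clique d∉K key key-inj key∈ = ω-bound (suc m) f f-inj f-clique
    where
    f : Fin (suc m) → Fin n
    f zero    = d
    f (suc i) = key i
    f-inj : Injective _≡_ _≡_ f
    f-inj {zero}  {zero}  _   = refl
    f-inj {zero}  {suc j} d≡  = contradiction (subst (_∈ K) (sym d≡) (proj₁ (key∈ j))) d∉K
    f-inj {suc i} {zero}  ≡d  = contradiction (subst (_∈ K) ≡d (proj₁ (key∈ i))) d∉K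
    f-inj {suc i} {suc j} eq  = cong suc (key-inj eq)
    f-clique : ∀ i j → i ≢ j → f i ~ f j
    f-clique zero    zero    i≢j = contradiction refl i≢j
    f-clique zero    (suc j) _   = proj₂ (key∈ j)
    f-clique (suc i) zero    _   = ~-sym (proj₂ (key∈ i))
    f-clique (suc i) (suc j) i≢j = clique (proj₁ (key∈ i)) (proj₁ (key∈ j)) (i≢j ∘ cong suc ∘ key-inj)

  module _ (chordal : Chordal H) where

    long-cycle-has-chord : ∀ {c L} → 3 ≤ L → IsCycle c L → Chord c L
    long-cycle-has-chord {c} {L} 3≤L cyc
      with chordal (suc L) (s≤s 3≤L) (c ∘ toℕ) injective′ edges
      where
      open IsCycle cyc
      injective′ : Injective _≡_ _≡_ (c ∘ toℕ)
      injective′ {i} {j} eq = toℕ-injective (injective _ _ (≤-pred (toℕ<n i)) (≤-pred (toℕ<n j)) eq)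
      edges : ∀ i j → CycNext H (suc L) i j → TAdj H (c (toℕ i)) (c (toℕ j))
      edges i j (inj₁ i+1≡j) = subst (λ m → c (toℕ i) ~ c m) i+1≡j
                                     (walk (toℕ i) (subst (_≤ L) (sym i+1≡j) (≤-pred (toℕ<n j))))
      edges i j (inj₂ (i+1≡L+1 , j≡0)) rewrite suc-injective i+1≡L+1 | j≡0 = closing
    ... | i , j , i≢j , ¬i→j , ¬j→i , i~j with <-cmp (toℕ i) (toℕ j)
    ...   | tri< i<j _ _ = toℕ i , toℕ j , i<j , ≤-pred (toℕ<n j) , ¬i→j ∘ inj₁ ,
                           (λ (i≡0 , j≡L) → ¬j→i (inj₂ (cong suc j≡L , i≡0))) , i~j
    ...   | tri≈ _ i≡j _ = contradiction (toℕ-injective i≡j) i≢j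
    ...   | tri> _ _ j<i = toℕ j , toℕ i , j<i , ≤-pred (toℕ<n i) , ¬j→i ∘ inj₁ ,
                           (λ (j≡0 , i≡L) → ¬i→j (inj₂ (cong suc i≡L , j≡0))) , ~-sym i~j

    -- Shortcutting along a chord keeps the closing edge, so induction on the length applies.
    cycle-triangle : ∀ bound {c L} → L ≤ bound → 2 ≤ L → IsCycle c L → Triangle c L
    cycle-triangle _ {L = 0} _ () _
    cycle-triangle _ {L = 1} _ (s≤s ()) _
    cycle-triangle zero {L = suc (suc (suc _))} () _ _
    cycle-triangle _ {c} {2} _ _ cyc = 1 , s≤s z≤n , s≤s (s≤s z≤n) , ~-sym (walk 0 (s≤s z≤n)) , walk 1 ≤-refl
      where open IsCycle cyc
    cycle-triangle (suc bound) {c} {L@(suc (suc (suc _)))} L≤ _ cyc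
      with long-cycle-has-chord (s≤s (s≤s (s≤s z≤n))) cyc
    ... | a , suc b , a<b+1 , b+1≤L , a+1≢b+1 , ¬ends , ca~cb+1 =
      let (m , 0<m , m<L′ , m~0 , m~L′) = cycle-triangle bound L′≤ 2≤L′ cyc′
      in skip a gap m , <-≤-trans 0<m (m≤skip m) , skip-bound-< m<L′ ,
         subst₂ _~_ refl shortcut-start m~0 , subst₂ _~_ refl end m~L′
      where
      open IsCycle cyc
      a<b : a < b
      a<b = ≤∧≢⇒< (≤-pred a<b+1) (a+1≢b+1 ∘ cong suc)
      open Shortcut c (<⇒≤ a<b) (<⇒≤ b+1≤L)
      open Skip a gap using (m≤skip)
      end : shortcut length′ ≡ c L
      end = shortcut-end (λ b≡L → contradiction b+1≤L (subst (λ x → ¬ suc x ≤ L) (sym b≡L) 1+n≰n))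
      L′≤ : length′ ≤ bound
      L′≤ = ≤-pred (<-≤-trans (subst (length′ <_) length′+gap≡k (m<m+n length′ (m<n⇒0<n∸m a<b))) L≤)
      2≤L′ : 2 ≤ length′
      2≤L′ = long a ¬ends
        where
        long : ∀ a → ¬ (a ≡ 0 × suc b ≡ L) → 2 ≤ a + (L ∸ b)
        long (suc a′) _   = s≤s (≤-trans (m<n⇒0<n∸m b+1≤L) (m≤n+m _ a′))
        long zero ¬ends′ = ≤-<-trans (m<n⇒0<n∸m (≤∧≢⇒< b+1≤L (λ e → ¬ends′ (refl , e))))
                                     (∸-monoʳ-< (n<1+n b) b+1≤L)
      cyc′ : IsCycle shortcut length′
      cyc′ = record
        { injective = shortcut-injective injective
        ; walk = shortcut-walk walk (λ _ → ca~cb+1)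
        ; closing = subst₂ _~_ (sym end) (sym shortcut-start) closing
        }

    -- Let p k₀ be the first vertex of the walk adjacent to c. If it saw every neighbour of d in K it
    -- would beat d; otherwise some c′ ∈ K ∩ N(d) misses it, and a simple walk from d to p k₀ closed by
    -- c and c′ is a cycle whose edge c c′ has no common neighbour on it: p k₀ is the only one seeing c.
    max-degree-sees-reachable :
      ExcludedMiddle 0ℓ → ∀ {K D : List (Fin n)} {d} → IsClique K → (∀ {x} → x ∈ D → x ∉ K) →
      (∀ {x} → x ∈ D → degreeIn x K ≤ degreeIn d K) →
      ∀ {p k} → IsWalk p k → p 0 ≡ d → (∀ m → m ≤ k → p m ∈ D) → ∀ {c} → c ∈ K → p k ~ c → d ~ c
    max-degree-sees-reachable em {K} {D} {d} clique D∩K=∅ maximal {p} {k} p-walk p₀≡d inD {c} c∈K pₖ~c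
      with d ~? c
    ... | yes d~c = d~c
    ... | no ¬d~c with least-witness (λ m → p m ~? c) k pₖ~c
    ...   | k₀ , k₀≤k , pk₀~c , earlier with em {∃ λ c′ → c′ ∈ K × d ~ c′ × ¬ p k₀ ~ c′}
    ...     | no ¬separated = contradiction (maximal (inD k₀ k₀≤k)) (<⇒≱ more)
      where
      sees : ∀ {z} → z ∈ K → d ~ z → p k₀ ~ z
      sees {z} z∈K d~z with p k₀ ~? z
      ... | yes pk₀~z = pk₀~z
      ... | no ¬pk₀~z = contradiction (z , z∈K , d~z , ¬pk₀~z) ¬separated
      more : degreeIn d K < degreeIn (p k₀) K
      more = length-filter-mono-< (d ~?_) (p k₀ ~?_) K sees c∈K pk₀~c ¬d~c
    ...     | yes (c′ , c′∈K , d~c′ , ¬pk₀~c′) =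
      ⊥-elim (from-triangle (cycle-triangle _ ≤-refl (s≤s (s≤s z≤n)) cyc))
      where
      open SimpleSubwalk (loop-erase em k₀ k₀ ≤-refl p (λ m m< → p-walk m (<-≤-trans m< k₀≤k)))
      open Bracket c′ c vertex len
      outside : ∀ m → m ≤ len → vertex m ≢ c′ × vertex m ≢ c
      outside m m≤ =
        let (m′ , m′≤ , eq) = visits m m≤
            pm′∉K = D∩K=∅ (inD m′ (≤-trans m′≤ k₀≤k))
        in (λ e → pm′∉K (subst (_∈ K) (trans (sym e) eq) c′∈K)) ,
           (λ e → pm′∉K (subst (_∈ K) (trans (sym e) eq) c∈K))
      c′≢c : c′ ≢ c
      c′≢c refl = ¬d~c d~c′
      cyc : IsCycle cycle (suc (suc len))
      cyc = record
        { injective = cycle-injective injective c′≢c outside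
        ; walk = cycle-walk walk (~-sym (subst (_~ c′) (sym (trans start p₀≡d)) d~c′)) (subst (_~ c) (sym end) pk₀~c)
        ; closing = subst (_~ c′) (sym cycle-last) (clique c∈K c′∈K (c′≢c ∘ sym))
        }
      from-triangle : Triangle cycle (suc (suc len)) → ⊥
      from-triangle (zero , () , _)
      from-triangle (suc m , _ , m<L , m~c′ , m~c) = ¬pk₀~c′ (subst (_~ c′) (trans (cycle-inner m≤len) at-k₀) m~c′)
        where
        m≤len : m ≤ len
        m≤len = ≤-pred (≤-pred m<L)
        m′ = proj₁ (visits m m≤len)
        m′≤k₀ = proj₁ (proj₂ (visits m m≤len))
        vm≡pm′ = proj₂ (proj₂ (visits m m≤len))
        vm~c : vertex m ~ c
        vm~c = subst₂ _~_ (cycle-inner m≤len) cycle-last m~c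
        at-k₀ : vertex m ≡ p k₀
        at-k₀ = trans vm≡pm′ (cong p (≤-antisym m′≤k₀ (≮⇒≥ λ m′<k₀ →
                  earlier m′ m′<k₀ (subst (_~ c) vm≡pm′ vm~c))))

module Tree (t : ℕ) where
  open Construction t

  depth : Vtx → ℕ
  depth root                = 0
  depth (child p _ _ _ _) = suc (depth p)

  IsChildOf-depth : ∀ {p c} → IsChildOf p c → depth c ≡ suc (depth p)
  IsChildOf-depth {c = child _ _ _ _ _} refl = refl

  up-self : ∀ v → v ∈ up v
  up-self root                = here refl
  up-self (child _ _ _ _ _) = here refl

  select-up⁻ : ∀ p B R {w} → w ∈ select (up p) B ++ select (up p) R → w ∈ up p
  select-up⁻ p B R w∈ = [ select-⊆ (up p) B , select-⊆ (up p) R ]′ (∈-++⁻ (select (up p) B) w∈)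

  up-depth : ∀ v {w} → w ∈ up v → depth w ≤ depth v
  up-depth root                (here refl) = ≤-refl
  up-depth (child p B R _ _) (here refl) = ≤-refl
  up-depth (child p B R _ _) (there w∈)  = m≤n⇒m≤1+n (up-depth p (select-up⁻ p B R w∈))

  up-Unique : ∀ v → Unique (up v)
  up-Unique root                = [] ∷ []
  up-Unique (child p B R B∩R=∅ _) =
    All.tabulate (λ w∈ v≡w → 1+n≰n (subst (λ x → depth x ≤ depth p) (sym v≡w)
                                          (up-depth p (select-up⁻ p B R w∈)))) ∷
    ++⁺ (select-Unique (up p) B (up-Unique p)) (select-Unique (up p) R (up-Unique p))
        (select-disjoint (up p) B R (up-Unique p) B∩R=∅)

  module _ (rank : Vtx → ℕ) where
    open Edges rank

    ≺-depth : ∀ {v w} → v ≺ w → depth v ≡ depth w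
    ≺-depth {child p _ _ _ _} {child q _ _ _ _} (inj₁ p≺q)       = cong suc (≺-depth p≺q)
    ≺-depth {child p _ _ _ _} {child q _ _ _ _} (inj₂ (refl , _)) = refl

    Consec-depth : ∀ {v w} → Consec v w → depth v ≡ depth w
    Consec-depth (v≺w , _) = ≺-depth v≺w

module Paths (em : ExcludedMiddle 0ℓ) (t : ℕ) (X : Construction.Vtx t → Set) where
  open Construction t

  BoundedPath : Vtx → ℕ → Set
  BoundedPath v b = Σ (ℕ → Vtx) λ s → DownwardPath v s × PathHitsAtMost s X b

  HitsBelow : Vtx → ℕ → Set
  HitsBelow y m = ∀ {c} → IsChildOf y c → ∀ {b} → BoundedPath c b → m ≤ b

  ◂-DownwardPath : ∀ {z c s} → IsChildOf z c → DownwardPath c s → DownwardPath z (z ◂ s)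
  ◂-DownwardPath {z} {c} {s} z→c (s₀≡c , steps) = refl , step
    where
    step : ∀ i → IsChildOf ((z ◂ s) i) ((z ◂ s) (suc i))
    step zero    = subst (IsChildOf z) (sym s₀≡c) z→c
    step (suc i) = steps i

  BoundedPath-prepend-∉ : ∀ {z c b} → ¬ X z → IsChildOf z c → BoundedPath c b → BoundedPath z b
  BoundedPath-prepend-∉ {z} ¬Xz z→c (s , down , hits) = z ◂ s , ◂-DownwardPath z→c down , hits′
    where
    hits′ : PathHitsAtMost (z ◂ s) X _
    hits′ m f f-inj on = hits m f f-inj on′
      where
      on′ : ∀ j → X (f j) × ∃ λ i → s i ≡ f j
      on′ j with on j
      ... | x , zero  , z≡fj = contradiction (subst X (sym z≡fj) x) ¬Xz
      ... | x , suc i , eq   = x , i , eq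

  BoundedPath-prepend : ∀ {z c b} → IsChildOf z c → BoundedPath c b → BoundedPath z (suc b)
  BoundedPath-prepend {z} z→c (s , down , hits) = z ◂ s , ◂-DownwardPath z→c down , hits′
    where
    hits′ : PathHitsAtMost (z ◂ s) X _
    hits′ m f f-inj on with em {∃ λ j → f j ≡ z}
    ... | no z∉f = m≤n⇒m≤1+n (hits m f f-inj on′)
      where
      on′ : ∀ j → X (f j) × ∃ λ i → s i ≡ f j
      on′ j with on j
      ... | x , zero  , z≡fj = contradiction (j , sym z≡fj) z∉f
      ... | x , suc i , eq   = x , i , eq
    hits′ (suc m) f f-inj on | yes (j₀ , fj₀≡z) =
      s≤s (hits m (f ∘ punchIn j₀) (punchIn-injective j₀ _ _ ∘ f-inj) on′)
      where
      on′ : ∀ j → X (f (punchIn j₀ j)) × ∃ λ i → s i ≡ f (punchIn j₀ j)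
      on′ j with on (punchIn j₀ j)
      ... | x , zero  , z≡f = contradiction (sym (f-inj (trans fj₀≡z z≡f))) (punchInᵢ≢i j₀ j)
      ... | x , suc i , eq  = x , i , eq

  BoundedPath-mono : ∀ {v b b′} → b ≤ b′ → BoundedPath v b → BoundedPath v b′
  BoundedPath-mono b≤b′ (s , down , hits) = s , down , λ m f f-inj on → ≤-trans (hits m f f-inj on) b≤b′

  avoiding⇒BoundedPath : ∀ {v s} → DownwardPath v s → (∀ i → ¬ X (s i)) → BoundedPath v 0
  avoiding⇒BoundedPath {s = s} down avoids = s , down , hits
    where
    hits : PathHitsAtMost s X 0
    hits zero    _ _ _  = z≤n
    hits (suc m) f _ on = let (x , i , eq) = on zero in contradiction (subst X (sym eq) x) (avoids i)

  HitsBelow-mono : ∀ {y m m′} → m′ ≤ m → HitsBelow y m → HitsBelow y m′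
  HitsBelow-mono m′≤m below y→c path = ≤-trans m′≤m (below y→c path)

  HitsBelow-child-∉ : ∀ {y z m} → HitsBelow y m → IsChildOf y z → ¬ X z → HitsBelow z m
  HitsBelow-child-∉ below y→z ¬Xz z→c path = below y→z (BoundedPath-prepend-∉ ¬Xz z→c path)

  HitsBelow-child : ∀ {y z m} → HitsBelow y (suc m) → IsChildOf y z → HitsBelow z m
  HitsBelow-child below y→z z→c path = ≤-pred (below y→z (BoundedPath-prepend z→c path))

  ¬BoundedPath⇒HitsBelow : ∀ {u m} → ¬ BoundedPath u m → HitsBelow u m
  ¬BoundedPath⇒HitsBelow {m = m} none u→c {b} path with m ≤? b
  ... | yes m≤b = m≤b
  ... | no m≰b  = contradiction (BoundedPath-mono (≰⇒> m≰b) (BoundedPath-prepend u→c path)) none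

  ¬BoundedPath⇒HitsBelow-∉ : ∀ {u m} → ¬ X u → ¬ BoundedPath u m → HitsBelow u (suc m)
  ¬BoundedPath⇒HitsBelow-∉ {m = m} ¬Xu none u→c {b} path with suc m ≤? b
  ... | yes m<b = m<b
  ... | no m≮b  = contradiction (BoundedPath-mono (≤-pred (≰⇒> m≮b)) (BoundedPath-prepend-∉ ¬Xu u→c path)) none

  iterate-DownwardPath : ∀ (next : Vtx → Vtx) → (∀ p → IsChildOf p (next p)) → ∀ v → DownwardPath v (iterate next v)
  iterate-DownwardPath next p→next v = refl , step v
    where
    step : ∀ v i → IsChildOf (iterate next v i) (iterate next v (suc i))
    step v zero    = p→next v
    step v (suc i) = step (next v) i

  module Descent (next : Vtx → Vtx) (next-child : ∀ p → IsChildOf p (next p))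
                 (Inv : Vtx → Set) (Inv-next : ∀ {p} → Inv p → Inv (next p))
                 (Blocked : Vtx → Set) (weight : Vtx → ℕ)
                 (weight-next : ∀ p → weight (next p) ≤ weight p)
                 (weight-blocked : ∀ p → Blocked (next p) → weight (next p) < weight p) where
    open Tree t using (depth; IsChildOf-depth)

    depth-next : ∀ p → depth (next p) ≡ suc (depth p)
    depth-next p = IsChildOf-depth (next-child p)

    record Landing (z : Vtx) (m : ℕ) : Set where
      field
        parent    : Vtx
        inv       : Inv parent
        inX       : X (next parent)
        unblocked : ¬ Blocked (next parent)
        deeper    : depth z < depth (next parent)
        budget    : HitsBelow (next parent) (m + weight (next parent))

    NextHit : Vtx → ℕ → Set
    NextHit z m = ∃ λ p → Inv p × depth z ≤ depth p × weight p ≤ weight z × X (next p) × HitsBelow p (suc m)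

    next-hit-within : ∀ i {z m} → Inv z → HitsBelow z (suc m) → X (iterate next (next z) i) → NextHit z m
    next-hit-within i {z} inv below Xi with em {X (next z)}
    ... | yes X-next = z , inv , ≤-refl , ≤-refl , X-next , below
    next-hit-within zero    inv below Xi | no ¬X-next = contradiction Xi ¬X-next
    next-hit-within (suc i) {z} inv below Xi | no ¬X-next =
      let (p , inv-p , z′≤p , w≤ , X-p , below-p) =
            next-hit-within i (Inv-next inv) (HitsBelow-child-∉ below (next-child z) ¬X-next) Xi
      in p , inv-p , ≤-trans (≤-trans (n≤1+n _) (≤-reflexive (sym (depth-next z)))) z′≤p ,
         ≤-trans w≤ (weight-next z) , X-p , below-p

    next-hit : ∀ {z m} → Inv z → HitsBelow z (suc m) → NextHit z m
    next-hit {z} inv below with em {∃ λ i → X (iterate next (next z) i)}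
    ... | yes (i , Xi) = next-hit-within i inv below Xi
    ... | no none = contradiction (below (next-child z) path₀) λ ()
      where
      path₀ = avoiding⇒BoundedPath (iterate-DownwardPath next next-child (next z)) (λ i Xi → none (i , Xi))

    -- A blocked vertex of X on the way uses up one hit but also lowers the weight, so the budget
    -- suc m + weight lasts until an unblocked vertex of X is reached.
    land : ∀ bound {z} m → weight z ≤ bound → Inv z → HitsBelow z (suc m + weight z) → Landing z m
    land bound {z} m w≤ inv below with next-hit inv below
    ... | p , inv-p , z≤p , wp≤wz , X-p , below-p with em {Blocked (next p)}
    ...   | no free = record
      { parent = p ; inv = inv-p ; inX = X-p ; unblocked = free
      ; deeper = subst (depth z <_) (sym (depth-next p)) (s≤s z≤p)
      ; budget = HitsBelow-mono (+-monoʳ-≤ m (≤-trans (weight-next p) wp≤wz)) (HitsBelow-child below-p (next-child p))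
      }
    ...   | yes blocked with bound
    ...     | zero = contradiction (≤-trans (weight-blocked p blocked) (≤-trans wp≤wz w≤)) λ ()
    ...     | suc bound′ = record
      { parent = L.parent ; inv = L.inv ; inX = L.inX ; unblocked = L.unblocked ; budget = L.budget
      ; deeper = <-trans (subst (depth z <_) (sym (depth-next p)) (s≤s z≤p)) L.deeper
      }
      where
      lighter : weight (next p) < weight z
      lighter = <-≤-trans (weight-blocked p blocked) wp≤wz
      module L = Landing (land bound′ m (≤-pred (≤-trans lighter w≤)) (Inv-next inv-p)
                  (HitsBelow-mono (subst (_≤ m + weight z) (+-suc m _) (+-monoʳ-≤ m lighter))
                                  (HitsBelow-child below-p (next-child p))))

data Colour : Set where
  black red : Colour

module Placements (t : ℕ) (rank : Construction.Vtx t → ℕ) (H : Trigraph)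
                  (X : Construction.Vtx t → Set) (floor : ℕ) where
  open Construction t
  open Edges rank
  open Trigraph H using (n; black-sym; red-sym)
  open TotalGraph H using (_~_)
  open Tree t

  Edgeᶜ : Colour → Fin n → Fin n → Set
  Edgeᶜ black i j = T (Trigraph.black H i j)
  Edgeᶜ red   i j = T (Trigraph.red H i j)

  Upᶜ : Colour → Vtx → Vtx → Set
  Upᶜ black = UpBlack
  Upᶜ red   = UpRed

  Edgeᶜ⇒~ : ∀ κ {i j} → Edgeᶜ κ i j → i ~ j
  Edgeᶜ⇒~ black = Equivalence.from T-∨ ∘ inj₁
  Edgeᶜ⇒~ red   = Equivalence.from T-∨ ∘ inj₂

  ~⇒Edgeᶜ : ∀ {i j} → i ~ j → ∃ λ κ → Edgeᶜ κ i j
  ~⇒Edgeᶜ = [ (black ,_) , (red ,_) ]′ ∘ Equivalence.to T-∨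

  Upᶜ⇒∈up : ∀ κ {v w} → Upᶜ κ v w → w ∈ up v
  Upᶜ⇒∈up black {child p B R _ _} w∈ = there (∈-++⁺ˡ w∈)
  Upᶜ⇒∈up red   {child p B R _ _} w∈ = there (∈-++⁺ʳ (select (up p) B) w∈)

  Upᶜ-depth : ∀ κ {v w} → Upᶜ κ v w → depth w < depth v
  Upᶜ-depth black {child p B R _ _} w∈ = s≤s (up-depth p (select-⊆ (up p) B w∈))
  Upᶜ-depth red   {child p B R _ _} w∈ = s≤s (up-depth p (select-⊆ (up p) R w∈))

  Placement : Set
  Placement = List (Fin n × Vtx)

  -- Up-neighbours of v above depth floor are harmless: no vertex of H is placed there.
  record Fits (h : Placement) (e : Fin n) (v : Vtx) : Set where
    field
      inX   : X v
      fresh : ∀ {e′ w} → (e′ , w) ∈ h → e ≢ e′ × v ≢ w × ¬ Consec v w × ¬ Consec w v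
      deep  : floor ≤ depth v
      up⁻   : ∀ κ {z} → Upᶜ κ v z → (∃ λ e′ → (e′ , z) ∈ h × Edgeᶜ κ e e′) ⊎ depth z < floor
      up⁺   : ∀ κ {e′ w} → (e′ , w) ∈ h → Edgeᶜ κ e e′ → Upᶜ κ v w

  data Valid : Placement → Set where
    []  : Valid []
    _∷_ : ∀ {h e v} → Fits h e v → Valid h → Valid ((e , v) ∷ h)

  Valid-functional : ∀ {h} → Valid h → ∀ {e v v′} → (e , v) ∈ h → (e , v′) ∈ h → v ≡ v′
  Valid-functional (_ ∷ _)     (here refl) (here refl) = refl
  Valid-functional (fits ∷ _)  (here refl) (there m)   = contradiction refl (proj₁ (Fits.fresh fits m))
  Valid-functional (fits ∷ _)  (there m)   (here refl) = contradiction refl (proj₁ (Fits.fresh fits m))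
  Valid-functional (_ ∷ valid) (there m)   (there m′)  = Valid-functional valid m m′

  Valid-injective : ∀ {h} → Valid h → ∀ {e e′ v} → (e , v) ∈ h → (e′ , v) ∈ h → e ≡ e′
  Valid-injective (_ ∷ _)     (here refl) (here refl) = refl
  Valid-injective (fits ∷ _)  (here refl) (there m)   = contradiction refl (proj₁ (proj₂ (Fits.fresh fits m)))
  Valid-injective (fits ∷ _)  (there m)   (here refl) = contradiction refl (proj₁ (proj₂ (Fits.fresh fits m)))
  Valid-injective (_ ∷ valid) (there m)   (there m′)  = Valid-injective valid m m′

  Valid-inX : ∀ {h} → Valid h → ∀ {e v} → (e , v) ∈ h → X v
  Valid-inX (fits ∷ _)  (here refl) = Fits.inX fits
  Valid-inX (_ ∷ valid) (there m)   = Valid-inX valid m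

  Valid-deep : ∀ {h} → Valid h → ∀ {e v} → (e , v) ∈ h → floor ≤ depth v
  Valid-deep (fits ∷ _)  (here refl) = Fits.deep fits
  Valid-deep (_ ∷ valid) (there m)   = Valid-deep valid m

  Valid-up⁻ : ∀ {h} → Valid h → ∀ κ {e v z} → (e , v) ∈ h → Upᶜ κ v z →
              (∃ λ e′ → (e′ , z) ∈ h) ⊎ depth z < floor
  Valid-up⁻ (fits ∷ _)  κ (here refl) u = Sum.map₁ (λ (e′ , m , _) → e′ , there m) (Fits.up⁻ fits κ u)
  Valid-up⁻ (_ ∷ valid) κ (there m)   u = Sum.map₁ (λ (e′ , m′) → e′ , there m′) (Valid-up⁻ valid κ m u)

  Faithful : Fin n → Vtx → Fin n → Vtx → Set
  Faithful i v j w = (T (Trigraph.black H i j) ⇔ Black v w) × (T (Trigraph.red H i j) ⇔ Red v w)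

  module _ {h e v} (valid : Valid h) (fits : Fits h e v) where
    open Fits fits

    fits-up⇔ : ∀ κ {j w} → (j , w) ∈ h → Edgeᶜ κ e j ⇔ (Upᶜ κ v w ⊎ Upᶜ κ w v)
    fits-up⇔ κ {j} {w} jw∈h = mk⇔ (inj₁ ∘ up⁺ κ jw∈h) from
      where
      from : Upᶜ κ v w ⊎ Upᶜ κ w v → Edgeᶜ κ e j
      from (inj₁ v→w) with up⁻ κ v→w
      ... | inj₁ (e′ , e′w∈h , e~e′) = subst (Edgeᶜ κ e) (Valid-injective valid e′w∈h jw∈h) e~e′
      ... | inj₂ shallow = contradiction (Valid-deep valid jw∈h) (<⇒≱ shallow)
      from (inj₂ w→v) with Valid-up⁻ valid κ jw∈h w→v
      ... | inj₁ (e′ , e′v∈h) = contradiction refl (proj₁ (proj₂ (fresh e′v∈h)))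
      ... | inj₂ shallow = contradiction deep (<⇒≱ shallow)

    fits-faithful : ∀ {j w} → (j , w) ∈ h → Faithful e v j w
    fits-faithful {j} {w} jw∈h = mk⇔ (inj₂ ∘ inj₂ ∘ Equivalence.to black⇔) from-black , fits-up⇔ red jw∈h
      where
      black⇔ = fits-up⇔ black jw∈h
      from-black : Black v w → T (Trigraph.black H e j)
      from-black (inj₁ consec)       = contradiction consec (proj₁ (proj₂ (proj₂ (fresh jw∈h))))
      from-black (inj₂ (inj₁ consec)) = contradiction consec (proj₂ (proj₂ (proj₂ (fresh jw∈h))))
      from-black (inj₂ (inj₂ up))     = Equivalence.from black⇔ up

  Faithful-sym : ∀ {i v j w} → Faithful i v j w → Faithful j w i v
  Faithful-sym {i} {v} {j} {w} (b , r) =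
    mk⇔ (Black-sym ∘ Equivalence.to b ∘ subst T (black-sym j i)) (subst T (black-sym i j) ∘ Equivalence.from b ∘ Black-sym) ,
    mk⇔ (Red-sym ∘ Equivalence.to r ∘ subst T (red-sym j i)) (subst T (red-sym i j) ∘ Equivalence.from r ∘ Red-sym)
    where
    Black-sym : ∀ {v w} → Black v w → Black w v
    Black-sym = [ inj₂ ∘ inj₁ , [ inj₁ , inj₂ ∘ inj₂ ∘ Sum.swap ]′ ]′
    Red-sym : ∀ {v w} → Red v w → Red w v
    Red-sym = Sum.swap

  Valid-faithful : ∀ {h} → Valid h → ∀ {i v j w} → (i , v) ∈ h → (j , w) ∈ h → i ≢ j → Faithful i v j w
  Valid-faithful (_ ∷ _)         (here refl) (here refl) i≢j = contradiction refl i≢j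
  Valid-faithful (fits ∷ valid)  (here refl) (there m)   _   = fits-faithful valid fits m
  Valid-faithful (fits ∷ valid)  (there m)   (here refl) _   = Faithful-sym (fits-faithful valid fits m)
  Valid-faithful (_ ∷ valid)     (there m)   (there m′)  i≢j = Valid-faithful valid m m′ i≢j

  Valid⇒ContainsInduced : ∀ {h} → Valid h → (∀ e → ∃ λ v → (e , v) ∈ h) → ContainsInduced H X
  Valid⇒ContainsInduced valid placed =
    proj₁ ∘ placed ,
    (λ {i} {j} eq → Valid-injective valid (proj₂ (placed i)) (subst (λ v → (j , v) ∈ _) (sym eq) (proj₂ (placed j)))) ,
    (λ i → Valid-inX valid (proj₂ (placed i))) ,
    (λ i j → Valid-faithful valid (proj₂ (placed i)) (proj₂ (placed j)))

  Deeper : ℕ → Pred (Fin n × Vtx) 0ℓ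
  Deeper a (_ , w) = a < depth w

  deeper? : ∀ a → Decidable (Deeper a)
  deeper? a (_ , w) = a <? depth w

  deeperThan : ℕ → Placement → ℕ
  deeperThan a h = length (filter (deeper? a) h)

  deeperThan-anti : ∀ {a b} h → a ≤ b → deeperThan b h ≤ deeperThan a h
  deeperThan-anti h a≤b = length-filter-mono (deeper? _) (deeper? _) h (λ _ → ≤-<-trans a≤b)

  deeperThan-strict : ∀ {a} h {e w} → (e , w) ∈ h → depth w ≡ suc a → deeperThan (suc a) h < deeperThan a h
  deeperThan-strict {a} h ew∈h depth≡ =
    length-filter-mono-< (deeper? _) (deeper? _) h (λ _ → <-trans (n<1+n a)) ew∈h
      (subst (a <_) (sym depth≡) (n<1+n a)) (λ a+1<d → <-irrefl (sym depth≡) a+1<d)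

  deeperThan-++ : ∀ a xs ys → deeperThan a (xs ++ ys) ≡ deeperThan a xs + deeperThan a ys
  deeperThan-++ a xs ys = trans (cong length (filter-++ (deeper? a) xs ys)) (length-++ (filter (deeper? a) xs))

  deeperThan-all : ∀ {a xs} → All (Deeper a) xs → deeperThan a xs ≡ length xs
  deeperThan-all {a} all = cong length (filter-all (deeper? a) all)

  deeperThan-∷-level : ∀ d x h → deeperThan (depth x) ((d , x) ∷ h) ≡ deeperThan (depth x) h
  deeperThan-∷-level d x h = cong length (filter-reject (deeper? (depth x)) (<-irrefl refl))

  deeperThan-∷-deeper : ∀ {a} d x h → a < depth x → deeperThan a ((d , x) ∷ h) ≡ suc (deeperThan a h)
  deeperThan-∷-deeper {a} d x h a<x = cong length (filter-accept (deeper? a) a<x)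

  Clashes : Vtx → Placement → Set
  Clashes v h = ∃ λ ew → ew ∈ h × (v ≡ proj₂ ew ⊎ Consec v (proj₂ ew) ⊎ Consec (proj₂ ew) v)

  Clashes⇒level-occupied : ∀ {v h} → Clashes v h → ∃ λ ew → ew ∈ h × depth (proj₂ ew) ≡ depth v
  Clashes⇒level-occupied (ew , ew∈h , inj₁ refl)         = ew , ew∈h , refl
  Clashes⇒level-occupied (ew , ew∈h , inj₂ (inj₁ consec)) = ew , ew∈h , sym (Consec-depth rank consec)
  Clashes⇒level-occupied (ew , ew∈h , inj₂ (inj₂ consec)) = ew , ew∈h , Consec-depth rank consec

module Extend (em : ExcludedMiddle 0ℓ) (t : ℕ) (rank : Construction.Vtx t → ℕ)
              (H : Trigraph) (chordal : Chordal H) (ω-bound : CliqueNumberAtMost H (suc t))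
              (X : Construction.Vtx t → Set) (floor : ℕ) where
  open Construction t
  open Trigraph H using (n; disjoint)
  open TotalGraph H
  open Tree t
  open Paths em t X
  open Placements t rank H X floor

  record Task (y : Vtx) (K D : List (Fin n)) (h : Placement) : Set where
    field
      valid      : Valid h
      K-placed   : ∀ {e} → e ∈ K → ∃ λ w → (e , w) ∈ h
      K-up       : ∀ {e w} → e ∈ K → (e , w) ∈ h → w ∈ up y
      K-clique   : IsClique K
      D-unplaced : ∀ {e w} → e ∈ D → (e , w) ∉ h
      D-boundary : ∀ {e e′ w} → e ∈ D → (e′ , w) ∈ h → e ~ e′ → e′ ∈ K
      budget     : HitsBelow y (length D + deeperThan (depth y) h)
      above      : floor ≤ depth y

  record Extension (y : Vtx) (D : List (Fin n)) (h : Placement) : Set where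
    field
      new    : Placement
      valid  : Valid (new ++ h)
      covers : ∀ {e} → e ∈ D → ∃ λ w → (e , w) ∈ new
      domain : ∀ {e w} → (e , w) ∈ new → e ∈ D
      below  : ∀ {e w} → (e , w) ∈ new → depth y < depth w
      size   : length new ≤ length D

  Extender : ℕ → Set
  Extender bound = ∀ {y K D h} → length D ≤ bound → Task y K D h → Extension y D h

  module Step (bound : ℕ) (recurse : Extender bound) {y K x₀ xs h}
              (xs≤ : length xs ≤ bound) (task : Task y K (x₀ ∷ xs) h) where
    open Task task

    D : List (Fin n)
    D = x₀ ∷ xs

    D∩K=∅ : ∀ {e} → e ∈ D → e ∉ K
    D∩K=∅ e∈D e∈K = let (w , ew∈h) = K-placed e∈K in D-unplaced e∈D ew∈h

    opaque
      d : Fin n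
      d = argmax (λ z → degreeIn z K) x₀ xs

      d∈D : d ∈ D
      d∈D = [ here , there ]′ (argmax-sel (λ z → degreeIn z K) x₀ xs)

      d-max : ∀ {z} → z ∈ D → degreeIn z K ≤ degreeIn d K
      d-max (here refl)  = f[⊥]≤f[argmax] {f = λ z → degreeIn z K} x₀ xs
      d-max (there z∈xs) = All.lookup (f[xs]≤f[argmax] {f = λ z → degreeIn z K} x₀ xs) z∈xs

    ImageOfNeighbour : Colour → Vtx → Set
    ImageOfNeighbour κ z = ∃ λ e′ → (e′ , z) ∈ h × e′ ∈ K × Edgeᶜ κ d e′

    ImageOfNeighbour-black-red : ∀ {z} → ImageOfNeighbour black z → ImageOfNeighbour red z → ⊥
    ImageOfNeighbour-black-red (e₁ , e₁z∈h , _ , b) (e₂ , e₂z∈h , _ , r) =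
      disjoint d e₁ b (subst (Edgeᶜ red d) (Valid-injective valid e₂z∈h e₁z∈h) r)

    neighbour-positions : (p : Vtx) → Subset (length (up p))
    neighbour-positions p = mask em (up p) (ImageOfNeighbour black) ∪ mask em (up p) (ImageOfNeighbour red)

    PlacedNeighbourAt : Vtx → Set
    PlacedNeighbourAt z = ∃ λ e′ → (e′ , z) ∈ h × e′ ∈ K × d ~ e′

    neighbour-positions⁻ : ∀ {p z} → z ∈ select (up p) (neighbour-positions p) → PlacedNeighbourAt z
    neighbour-positions⁻ {p} z∈ = [ from black , from red ]′ (select-∪⁻ (up p) _ _ z∈)
      where
      from : ∀ κ {z} → z ∈ select (up p) (mask em (up p) (ImageOfNeighbour κ)) → PlacedNeighbourAt z
      from κ z∈S = let (e′ , m , e′∈K , col) = proj₂ (mask⁻ em (up p) (ImageOfNeighbour κ) z∈S)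
                   in e′ , m , e′∈K , Edgeᶜ⇒~ κ col

    -- The vertices of H placed at these positions form a clique of 𝒯(H) together with d.
    neighbour-positions-size : ∀ p → ∣ neighbour-positions p ∣ ≤ t
    neighbour-positions-size p =
      subst (_≤ t) (sym (∣∣≡length-select (up p) (neighbour-positions p)))
            (≤-pred (clique-extension-bound ω-bound K-clique (D∩K=∅ d∈D) key key-injective key∈))
      where
      positions = select (up p) (neighbour-positions p)
      at : (i : Fin (length positions)) → PlacedNeighbourAt (lookup positions i)
      at i = neighbour-positions⁻ {p} (∈-lookup {xs = positions} i)
      key : Fin (length positions) → Fin n
      key = proj₁ ∘ at
      key∈ : ∀ i → key i ∈ K × d ~ key i
      key∈ = proj₂ ∘ proj₂ ∘ at
      key-injective : Injective _≡_ _≡_ key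
      key-injective {i} {j} eq =
        lookup-injective (select-Unique (up p) (neighbour-positions p) (up-Unique p)) i j
          (Valid-functional valid (proj₁ (proj₂ (at i)))
                                  (subst (λ e → (e , lookup positions j) ∈ h) (sym eq) (proj₁ (proj₂ (at j)))))

    NeighbourImagesUp : Vtx → Set
    NeighbourImagesUp p = ∀ {e′ w} → e′ ∈ K → (e′ , w) ∈ h → d ~ e′ → w ∈ up p

    opaque
      next : Vtx → Vtx
      next p = child p (mask em (up p) (ImageOfNeighbour black)) (mask em (up p) (ImageOfNeighbour red))
                       (mask-disjoint em (up p) _ _ ImageOfNeighbour-black-red) (≤⇒≤ᵇ (neighbour-positions-size p))

      next-child : ∀ p → IsChildOf p (next p)
      next-child p = refl

      up-next⁻ : ∀ κ p {z} → Upᶜ κ (next p) z → z ∈ up p × ImageOfNeighbour κ z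
      up-next⁻ black p = mask⁻ em (up p) (ImageOfNeighbour black)
      up-next⁻ red   p = mask⁻ em (up p) (ImageOfNeighbour red)

      up-next⁺ : ∀ κ p {z} → z ∈ up p → ImageOfNeighbour κ z → Upᶜ κ (next p) z
      up-next⁺ black p = mask⁺ em (up p) (ImageOfNeighbour black)
      up-next⁺ red   p = mask⁺ em (up p) (ImageOfNeighbour red)

      NeighbourImagesUp-next : ∀ {p} → NeighbourImagesUp p → NeighbourImagesUp (next p)
      NeighbourImagesUp-next {p} images-up e′∈K e′w∈h d~e′ =
        let (κ , col) = ~⇒Edgeᶜ d~e′
        in Upᶜ⇒∈up κ (up-next⁺ κ p (images-up e′∈K e′w∈h d~e′) (_ , e′w∈h , e′∈K , col))

    weight : Vtx → ℕ
    weight z = deeperThan (depth z) h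

    weight-next : ∀ p → weight (next p) ≤ weight p
    weight-next p = deeperThan-anti h (subst (depth p ≤_) (sym (IsChildOf-depth (next-child p))) (n≤1+n (depth p)))

    weight-blocked : ∀ p → Clashes (next p) h → weight (next p) < weight p
    weight-blocked p clash =
      let (_ , ew∈h , level) = Clashes⇒level-occupied clash
          next-level = IsChildOf-depth (next-child p)
      in subst (λ k → deeperThan k h < weight p) (sym next-level) (deeperThan-strict h ew∈h (trans level next-level))

    open Descent next next-child NeighbourImagesUp NeighbourImagesUp-next (λ v → Clashes v h) weight weight-next weight-blocked

    opaque
      landing : Landing y (length xs)
      landing = land (weight y) (length xs) ≤-refl (λ e′∈K e′w∈h _ → K-up e′∈K e′w∈h) budget

    open Landing landing
      renaming (inv to parent-images-up; inX to x∈X; unblocked to x-unblocked; deeper to y<x; budget to x-budget)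

    x : Vtx
    x = next parent

    fits : Fits h d x
    fits = record
      { inX   = x∈X
      ; fresh = λ {e′} {w} e′w∈h →
          (λ d≡e′ → D-unplaced d∈D (subst (λ e → (e , w) ∈ h) (sym d≡e′) e′w∈h)) ,
          (λ x≡w → x-unblocked (_ , e′w∈h , inj₁ x≡w)) ,
          (λ c → x-unblocked (_ , e′w∈h , inj₂ (inj₁ c))) ,
          (λ c → x-unblocked (_ , e′w∈h , inj₂ (inj₂ c)))
      ; deep  = ≤-trans above (<⇒≤ y<x)
      ; up⁻   = λ κ z∈ → let (e′ , m , _ , col) = proj₂ (up-next⁻ κ parent z∈) in inj₁ (e′ , m , col)
      ; up⁺   = λ κ e′w∈h col →
          let e′∈K = D-boundary d∈D e′w∈h (Edgeᶜ⇒~ κ col)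
          in up-next⁺ κ parent (parent-images-up e′∈K e′w∈h (Edgeᶜ⇒~ κ col)) (_ , e′w∈h , e′∈K , col)
      }

    h₁ : Placement
    h₁ = (d , x) ∷ h

    ≢d? : Decidable (_≢ d)
    ≢d? e = ¬? (e Fin.≟ d)

    D₁ : List (Fin n)
    D₁ = filter ≢d? D

    ∈D₁⁻ : ∀ {e} → e ∈ D₁ → e ∈ D × e ≢ d
    ∈D₁⁻ = ∈-filter⁻ ≢d?

    D₁-length : length D₁ ≤ length xs
    D₁-length = ≤-pred (filter-notAll ≢d? D (Any.map (λ d≡e e≢d → e≢d (sym d≡e)) d∈D))

    Escapes : Fin n → Set
    Escapes e = ∃₂ λ k q → q 0 ≡ e × IsWalk q k × (∀ j → j ≤ k → q j ∈ D₁) ×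
                ∃ λ c → c ∈ K × ¬ d ~ c × q k ~ c

    escapes? : Decidable Escapes
    escapes? e = em

    Escapes-base : ∀ {e c} → e ∈ D₁ → c ∈ K → ¬ d ~ c → e ~ c → Escapes e
    Escapes-base {e} e∈D₁ c∈K ¬d~c e~c = 0 , (λ _ → e) , refl , (λ _ ()) , (λ _ _ → e∈D₁) , _ , c∈K , ¬d~c , e~c

    Escapes-step : ∀ {e e′} → e′ ∈ D₁ → e′ ~ e → Escapes e → Escapes e′
    Escapes-step {e′ = e′} e′∈D₁ e′~e (k , q , q₀≡e , walk , inD₁ , rest) =
      suc k , e′ ◂ q , refl , ◂-IsWalk (subst (e′ ~_) (sym q₀≡e) e′~e) walk ,
      (λ { zero _ → e′∈D₁ ; (suc j) (s≤s j≤k) → inD₁ j j≤k }) , rest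

    Escapes⇒≁d : ∀ {e} → Escapes e → ¬ e ~ d
    Escapes⇒≁d (k , q , q₀≡e , walk , inD₁ , c , c∈K , ¬d~c , qₖ~c) e~d =
      ¬d~c (max-degree-sees-reachable chordal em K-clique D∩K=∅ d-max
              (◂-IsWalk (subst (d ~_) (sym q₀≡e) (~-sym e~d)) walk) refl inD c∈K qₖ~c)
      where
      inD : ∀ j → j ≤ suc k → (d ◂ q) j ∈ D
      inD zero    _         = d∈D
      inD (suc j) (s≤s j≤k) = proj₁ (∈D₁⁻ (inD₁ j j≤k))

    -- D-far is placed below y again: by max-degree-sees-reachable none of its vertices is adjacent to d.
    -- D-near is placed below x: its placed neighbours lie in {d} ∪ (K ∩ N(d)).
    D-far : List (Fin n)
    D-far = filter escapes? D₁

    D-near : List (Fin n)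
    D-near = filter (¬? ∘ escapes?) D₁

    ∈D-near⁻ : ∀ {e} → e ∈ D-near → e ∈ D₁ × ¬ Escapes e
    ∈D-near⁻ = ∈-filter⁻ (¬? ∘ escapes?)

    ∈D-far⁻ : ∀ {e} → e ∈ D-far → e ∈ D₁ × Escapes e
    ∈D-far⁻ = ∈-filter⁻ escapes?

    K-near : List (Fin n)
    K-near = d ∷ filter (d ~?_) K

    ∈K-near⁻ : ∀ {e} → e ∈ filter (d ~?_) K → e ∈ K × d ~ e
    ∈K-near⁻ = ∈-filter⁻ (d ~?_)

    near-task : Task x K-near D-near h₁
    near-task = record
      { valid      = fits ∷ valid
      ; K-placed   = λ { (here refl) → x , here refl
                       ; (there e∈) → map₂ there (K-placed (proj₁ (∈K-near⁻ e∈))) }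
      ; K-up       = K-up′
      ; K-clique   = K-clique′
      ; D-unplaced = D-unplaced′
      ; D-boundary = D-boundary′
      ; budget     = subst (λ k → HitsBelow x (length D-near + k)) (sym (deeperThan-∷-level d x h))
                           (HitsBelow-mono (+-monoˡ-≤ (weight x) (≤-trans (length-filter _ D₁) D₁-length)) x-budget)
      ; above      = ≤-trans above (<⇒≤ y<x)
      }
      where
      K-up′ : ∀ {e w} → e ∈ K-near → (e , w) ∈ h₁ → w ∈ up x
      K-up′ (here refl) (here refl) = up-self x
      K-up′ (here refl) (there m)   = contradiction m (D-unplaced d∈D)
      K-up′ (there e∈)  (here refl) = contradiction (proj₁ (∈K-near⁻ e∈)) (D∩K=∅ d∈D)
      K-up′ (there e∈)  (there m)   = let (e∈K , d~e) = ∈K-near⁻ e∈ in NeighbourImagesUp-next parent-images-up e∈K m d~e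
      K-clique′ : IsClique K-near
      K-clique′ (here refl) (here refl) a≢b = contradiction refl a≢b
      K-clique′ (here refl) (there b∈)  _   = proj₂ (∈K-near⁻ b∈)
      K-clique′ (there a∈)  (here refl) _   = ~-sym (proj₂ (∈K-near⁻ a∈))
      K-clique′ (there a∈)  (there b∈)  a≢b = K-clique (proj₁ (∈K-near⁻ a∈)) (proj₁ (∈K-near⁻ b∈)) a≢b
      D-unplaced′ : ∀ {e w} → e ∈ D-near → (e , w) ∉ h₁
      D-unplaced′ e∈ (here refl) = proj₂ (∈D₁⁻ (proj₁ (∈D-near⁻ e∈))) refl
      D-unplaced′ e∈ (there m)   = D-unplaced (proj₁ (∈D₁⁻ (proj₁ (∈D-near⁻ e∈)))) m
      D-boundary′ : ∀ {e e′ w} → e ∈ D-near → (e′ , w) ∈ h₁ → e ~ e′ → e′ ∈ K-near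
      D-boundary′ e∈ (here refl) _ = here refl
      D-boundary′ {e′ = e′} e∈ (there m) e~e′ = by-adjacency (d ~? e′)
        where
        e∈D₁ = proj₁ (∈D-near⁻ e∈)
        e′∈K = D-boundary (proj₁ (∈D₁⁻ e∈D₁)) m e~e′
        by-adjacency : Dec (d ~ e′) → e′ ∈ K-near
        by-adjacency (yes d~e′) = there (∈-filter⁺ (d ~?_) e′∈K d~e′)
        by-adjacency (no ¬d~e′) = contradiction (Escapes-base e∈D₁ e′∈K ¬d~e′ e~e′) (proj₂ (∈D-near⁻ e∈))

    part-bound : ∀ {P : Pred (Fin n) 0ℓ} (P? : Decidable P) → length (filter P? D₁) ≤ bound
    part-bound P? = ≤-trans (length-filter P? D₁) (≤-trans D₁-length xs≤)

    near : Extension x D-near h₁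
    near = recurse (part-bound _) near-task

    module N = Extension near

    h₂ : Placement
    h₂ = N.new ++ h₁

    ∈h₂⁻ : ∀ {e w} → (e , w) ∈ h₂ → e ∈ D-near ⊎ e ≡ d ⊎ (e , w) ∈ h
    ∈h₂⁻ m = Sum.map N.domain (λ { (here refl) → inj₁ refl ; (there m-h) → inj₂ m-h }) (∈-++⁻ N.new m)

    deeperThan-h₂ : deeperThan (depth y) h₂ ≡ length N.new + suc (weight y)
    deeperThan-h₂ = trans (deeperThan-++ (depth y) N.new h₁)
                          (cong₂ _+_ (deeperThan-all (All.tabulate (<-trans y<x ∘ N.below)))
                                     (deeperThan-∷-deeper d x h y<x))

    far-budget : length D-far + (length N.new + suc (weight y)) ≤ suc (length xs) + weight y
    far-budget = begin
      length D-far + (length N.new + suc (weight y))  ≤⟨ +-monoʳ-≤ (length D-far) (+-monoˡ-≤ _ N.size) ⟩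
      length D-far + (length D-near + suc (weight y)) ≡⟨ sym (+-assoc (length D-far) _ _) ⟩
      length D-far + length D-near + suc (weight y)   ≡⟨ cong (_+ suc (weight y)) (length-filter-+-¬ escapes? D₁) ⟩
      length D₁ + suc (weight y)                      ≤⟨ +-monoˡ-≤ _ D₁-length ⟩
      length xs + suc (weight y)                      ≡⟨ +-suc (length xs) (weight y) ⟩
      suc (length xs) + weight y                      ∎
      where open ≤-Reasoning

    far-task : Task y K D-far h₂
    far-task = record
      { valid      = N.valid
      ; K-placed   = map₂ (∈-++⁺ʳ N.new ∘ there) ∘ K-placed
      ; K-up       = λ e∈K m → K-up′ e∈K (∈h₂⁻ m)
      ; K-clique   = K-clique
      ; D-unplaced = λ e∈ m → D-unplaced′ (∈D-far⁻ e∈) (∈h₂⁻ m)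
      ; D-boundary = λ e∈ m e~e′ → D-boundary′ (∈D-far⁻ e∈) (∈h₂⁻ m) e~e′
      ; budget     = subst (λ k → HitsBelow y (length D-far + k)) (sym deeperThan-h₂)
                           (HitsBelow-mono far-budget budget)
      ; above      = above
      }
      where
      K-up′ : ∀ {e w} → e ∈ K → e ∈ D-near ⊎ e ≡ d ⊎ (e , w) ∈ h → w ∈ up y
      K-up′ e∈K (inj₁ e∈near)      = contradiction e∈K (D∩K=∅ (proj₁ (∈D₁⁻ (proj₁ (∈D-near⁻ e∈near)))))
      K-up′ e∈K (inj₂ (inj₁ refl)) = contradiction e∈K (D∩K=∅ d∈D)
      K-up′ e∈K (inj₂ (inj₂ m))    = K-up e∈K m
      D-unplaced′ : ∀ {e w} → e ∈ D₁ × Escapes e → ¬ (e ∈ D-near ⊎ e ≡ d ⊎ (e , w) ∈ h)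
      D-unplaced′ (_ , escapes) (inj₁ e∈near)      = proj₂ (∈D-near⁻ e∈near) escapes
      D-unplaced′ (e∈D₁ , _)   (inj₂ (inj₁ refl)) = proj₂ (∈D₁⁻ e∈D₁) refl
      D-unplaced′ (e∈D₁ , _)   (inj₂ (inj₂ m))    = D-unplaced (proj₁ (∈D₁⁻ e∈D₁)) m
      D-boundary′ : ∀ {e e′ w} → e ∈ D₁ × Escapes e → e′ ∈ D-near ⊎ e′ ≡ d ⊎ (e′ , w) ∈ h →
                    e ~ e′ → e′ ∈ K
      D-boundary′ (_ , escapes) (inj₁ e′∈near) e~e′ =
        let (e′∈D₁ , ¬escapes) = ∈D-near⁻ e′∈near
        in contradiction (Escapes-step e′∈D₁ (~-sym e~e′) escapes) ¬escapes
      D-boundary′ (_ , escapes) (inj₂ (inj₁ refl)) e~d  = contradiction e~d (Escapes⇒≁d escapes)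
      D-boundary′ (e∈D₁ , _)   (inj₂ (inj₂ m))    e~e′ = D-boundary (proj₁ (∈D₁⁻ e∈D₁)) m e~e′

    far : Extension y D-far h₂
    far = recurse (part-bound escapes?) far-task

    module F = Extension far

    new : Placement
    new = F.new ++ N.new ++ (d , x) ∷ []

    NewEntry : Fin n × Vtx → Set
    NewEntry ew = ew ∈ F.new ⊎ ew ∈ N.new ⊎ ew ≡ (d , x)

    ∈new⁺ : ∀ {ew} → NewEntry ew → ew ∈ new
    ∈new⁺ (inj₁ m)           = ∈-++⁺ˡ m
    ∈new⁺ (inj₂ (inj₁ m))    = ∈-++⁺ʳ F.new (∈-++⁺ˡ m)
    ∈new⁺ (inj₂ (inj₂ refl)) = ∈-++⁺ʳ F.new (∈-++⁺ʳ N.new (here refl))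

    ∈new⁻ : ∀ {ew} → ew ∈ new → NewEntry ew
    ∈new⁻ m = Sum.map₂ (Sum.map₂ (λ { (here eq) → eq ; (there ()) }) ∘ ∈-++⁻ N.new) (∈-++⁻ F.new m)

    new-covers : ∀ {e} → e ∈ D → Dec (e ≡ d) → Dec (Escapes e) → ∃ λ w → (e , w) ∈ new
    new-covers e∈D (yes refl) _           = x , ∈new⁺ (inj₂ (inj₂ refl))
    new-covers e∈D (no e≢d) (yes escapes) =
      map₂ (∈new⁺ ∘ inj₁) (F.covers (∈-filter⁺ escapes? (∈-filter⁺ ≢d? e∈D e≢d) escapes))
    new-covers e∈D (no e≢d) (no ¬escapes) =
      map₂ (∈new⁺ ∘ inj₂ ∘ inj₁) (N.covers (∈-filter⁺ (¬? ∘ escapes?) (∈-filter⁺ ≢d? e∈D e≢d) ¬escapes))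

    new-domain : ∀ {e w} → NewEntry (e , w) → e ∈ D
    new-domain (inj₁ m-far)         = proj₁ (∈D₁⁻ (proj₁ (∈D-far⁻ (F.domain m-far))))
    new-domain (inj₂ (inj₁ m-near)) = proj₁ (∈D₁⁻ (proj₁ (∈D-near⁻ (N.domain m-near))))
    new-domain (inj₂ (inj₂ refl))   = d∈D

    new-below : ∀ {e w} → NewEntry (e , w) → depth y < depth w
    new-below (inj₁ m-far)         = F.below m-far
    new-below (inj₂ (inj₁ m-near)) = <-trans y<x (N.below m-near)
    new-below (inj₂ (inj₂ refl))   = y<x

    new-size : length new ≤ length D
    new-size = begin
      length new                                  ≡⟨ length-++ F.new ⟩
      length F.new + length (N.new ++ (d , x) ∷ []) ≡⟨ cong (length F.new +_) (length-++ N.new) ⟩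
      length F.new + (length N.new + 1)           ≤⟨ +-mono-≤ F.size (+-monoˡ-≤ 1 N.size) ⟩
      length D-far + (length D-near + 1)          ≡⟨ sym (+-assoc (length D-far) _ 1) ⟩
      length D-far + length D-near + 1            ≡⟨ cong (_+ 1) (length-filter-+-¬ escapes? D₁) ⟩
      length D₁ + 1                               ≤⟨ +-monoˡ-≤ 1 D₁-length ⟩
      length xs + 1                               ≡⟨ +-comm (length xs) 1 ⟩
      length D                                    ∎
      where open ≤-Reasoning

    extension : Extension y D h
    extension = record
      { new    = new
      ; valid  = subst Valid new++h F.valid
      ; covers = λ {e} e∈D → new-covers e∈D (e Fin.≟ d) (escapes? e)
      ; domain = new-domain ∘ ∈new⁻
      ; below  = new-below ∘ ∈new⁻
      ; size   = new-size
      }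
      where
      new++h : F.new ++ h₂ ≡ new ++ h
      new++h = sym (trans (++-assoc F.new _ h) (cong (F.new ++_) (++-assoc N.new _ h)))

  extend : ∀ bound → Extender bound
  extend _           {D = []}     _          task = record
    { new = [] ; valid = Task.valid task ; covers = λ () ; domain = λ () ; below = λ () ; size = z≤n }
  extend zero        {D = _ ∷ _}  ()         _
  extend (suc bound) {D = _ ∷ _}  (s≤s xs≤) task = Step.extension bound (extend bound) xs≤ task

module Embed (em : ExcludedMiddle 0ℓ) (t : ℕ) (rank : Construction.Vtx t → ℕ)
             (H : Trigraph) (chordal : Chordal H) (ω-bound : CliqueNumberAtMost H (suc t))
             (X : Construction.Vtx t → Set) (u : Construction.Vtx t) where
  open Construction t
  open Edges rank using (ContainsInduced)
  open Trigraph H using (n)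
  open Tree t
  open Paths em t X
  open Placements t rank H X (depth u)
  open Extend em t rank H chordal ω-bound X (depth u)

  length-allFin : length (allFin n) ≡ n
  length-allFin = length-tabulate id

  contains-induced-when-∉ : ¬ X u → ¬ BoundedPath u (n ∸ 1) → ContainsInduced H X
  contains-induced-when-∉ ¬Xu none =
    Valid⇒ContainsInduced valid (λ e → map₂ ∈-++⁺ˡ (covers (∈-allFin e)))
    where
    task : Task u [] (allFin n) []
    task = record
      { valid = [] ; K-placed = λ () ; K-up = λ () ; K-clique = λ () ; D-unplaced = λ _ () ; D-boundary = λ _ ()
      ; budget = HitsBelow-mono (≤-trans (≤-reflexive (trans (+-identityʳ _) length-allFin)) (m≤n+m∸n n 1))
                                (¬BoundedPath⇒HitsBelow-∉ ¬Xu none)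
      ; above = ≤-refl
      }
    open Extension (extend n (≤-reflexive length-allFin) task)

  contains-induced-when-∈ : X u → ¬ BoundedPath u (n ∸ 1) → ContainsInduced H X
  contains-induced-when-∈ Xu none with em {Fin n}
  ... | no no-vertex = Valid⇒ContainsInduced [] (⊥-elim ∘ no-vertex)
  ... | yes d₀ = Valid⇒ContainsInduced valid placed
    where
    ≢d₀? : Decidable (_≢ d₀)
    ≢d₀? e = ¬? (e Fin.≟ d₀)
    D : List (Fin n)
    D = filter ≢d₀? (allFin n)
    D-length : length D ≤ n ∸ 1
    D-length = <⇒≤pred (subst (length D <_) length-allFin
                 (filter-notAll ≢d₀? (allFin n) (Any.map (λ d₀≡e e≢d₀ → e≢d₀ (sym d₀≡e)) (∈-allFin d₀))))
    fits₀ : Fits [] d₀ u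
    fits₀ = record
      { inX = Xu ; fresh = λ () ; deep = ≤-refl ; up⁻ = λ κ z∈ → inj₂ (Upᶜ-depth κ z∈) ; up⁺ = λ κ () }
    task : Task u (d₀ ∷ []) D ((d₀ , u) ∷ [])
    task = record
      { valid      = fits₀ ∷ []
      ; K-placed   = λ { (here refl) → u , here refl }
      ; K-up       = λ { (here refl) (here refl) → up-self u }
      ; K-clique   = λ { (here refl) (here refl) a≢b → contradiction refl a≢b }
      ; D-unplaced = λ { e∈D (here refl) → proj₂ (∈-filter⁻ ≢d₀? {xs = allFin n} e∈D) refl }
      ; D-boundary = λ { _ (here refl) _ → here refl }
      ; budget     = HitsBelow-mono (subst (λ k → length D + k ≤ n ∸ 1) (sym (deeperThan-∷-level d₀ u []))
                                           (≤-trans (≤-reflexive (+-identityʳ _)) D-length))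
                                    (¬BoundedPath⇒HitsBelow none)
      ; above      = ≤-refl
      }
    open Extension (extend n (≤-trans D-length (m∸n≤m n 1)) task)
    placed : ∀ e → ∃ λ w → (e , w) ∈ new ++ (d₀ , u) ∷ []
    placed e with e Fin.≟ d₀
    ... | yes refl = u , ∈-++⁺ʳ new (here refl)
    ... | no e≢d₀  = map₂ ∈-++⁺ˡ (covers (∈-filter⁺ ≢d₀? (∈-allFin e) e≢d₀))

  ¬BoundedPath⇒ContainsInduced : ¬ BoundedPath u (n ∸ 1) → ContainsInduced H X
  ¬BoundedPath⇒ContainsInduced none with em {X u}
  ... | yes Xu  = contains-induced-when-∈ Xu none
  ... | no ¬Xu = contains-induced-when-∉ ¬Xu none

lemma4p5 : ExcludedMiddle 0ℓ →
    (t : ℕ) → 1 ≤ t →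
    (rank : Construction.Vtx t → ℕ) → Construction.RankInjective t rank →
    (H : Trigraph) → Chordal H → CliqueNumberAtMost H (suc t) →
    (X : Construction.Vtx t → Set) → Construction.Edges.InducedFree t rank H X →
    (u : Construction.Vtx t) →
    Σ (ℕ → Construction.Vtx t) (λ s →
      Construction.DownwardPath t u s ×
      Construction.PathHitsAtMost t s X (Trigraph.n H ∸ 1))
lemma4p5 em t _ rank _ H chordal ω-bound X free u with em {Paths.BoundedPath em t X u (Trigraph.n H ∸ 1)}
... | yes path = path
... | no none  = ⊥-elim (free (Embed.¬BoundedPath⇒ContainsInduced em t rank H chordal ω-bound X u none))
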